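{- For all integers $n \geq 0$ and $k \geq 1$, \[ C(n,[k]) = F(n+1,k) - F(n+1-k,k). \]
   Context: A composition of $n$ is a finite sequence of positive integers summing to $n$. $C(n,[k])$ is the number of compositions of $n$ none of whose parts is a multiple of $k$. The $k$-step Fibonacci numbers are $F(n,k)=0$ for $n\le0$, $F(1,k)=1$, and $F(n,k)=\sum_{j=1}^k F(n-j,k)$ for $n\ge2$. -}

module Defs where

open import Data.Nat using (ℕ; zero; suc; _∸_; _%_; _≟_)
open import Data.Integer using (ℤ; +_; -[1+_]; _-_)
import Data.Integer as ℤ
open import Data.List using (List; []; _∷_; map; concatMap; take; upTo; length; filter)
open import Data.Bool using (Bool; not)
open import Data.Nat.ListAction using (sum)
open import Data.Bool.ListAction using (and)
open import Relation.Nullary.Decidable using (⌊_⌋)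

-- All compositions of m (lists of positive integers summing to m), enumerated
-- by choosing the first part p ∈ {1,…,m}; the fuel f bounds the number of parts
-- (a composition of m has at most m parts, so fuel m suffices).
compositionsF : ℕ → ℕ → List (List ℕ)
compositionsF _       zero    = [] ∷ []
compositionsF zero    (suc m) = []
compositionsF (suc f) (suc m) =
  concatMap (λ p → map (suc p ∷_) (compositionsF f (m ∸ p))) (upTo (suc m))

compositions : ℕ → List (List ℕ)
compositions n = compositionsF n n

multipleOf : (k : ℕ) → ℕ → Bool
multipleOf zero    a = ⌊ a ≟ 0 ⌋
multipleOf (suc k) a = ⌊ a % suc k ≟ 0 ⌋

C : ℕ → ℕ → ℕ
C n k = length (filter (λ c → and (map (λ a → not (multipleOf k a)) c) ≟B true) (compositions n))
  where
  open import Data.Bool using (true)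
  open import Data.Bool.Properties renaming (_≟_ to _≟B_)

-- Indices m ≤ 0 give 0, F(1) = 1, and
-- F(m) = Σ_{j=1}^{k} F(m-j) for m ≥ 2.
-- fibsDown k m = [F(m), F(m-1), …, F(1), F(0)] (natural-number indices),
-- computed structurally; each new value is the sum of the first k entries
-- of the previous list (missing entries, i.e. indices ≤ 0, contribute 0 since F(0)=0).
fibsDown : ℕ → ℕ → List ℕ
fibsDown k zero          = 0 ∷ []
fibsDown k (suc zero)    = 1 ∷ 0 ∷ []
fibsDown k (suc (suc m)) = step (fibsDown k (suc m))
  where
  step : List ℕ → List ℕ
  step prev = sum (take k prev) ∷ prev

Fℕ : ℕ → ℕ → ℕ
Fℕ k m = head′ (fibsDown k m)
  where
  head′ : List ℕ → ℕ
  head′ []      = 0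
  head′ (x ∷ _) = x

F : ℤ → ℕ → ℕ
F (+ m)    k = Fℕ k m
F -[1+ _ ] k = 0

module Submission where

-- Write c n = C(n,[k]) and f m = F(m,k) (natural indices, f 0 = 0).
--  * F satisfies the impulse recurrence  f 0 = 0,
--    f (m+1) = Σ_{p<k} f (m ∸ p) + [m = 0],  and any sequence satisfying it
--    equals f (`kStep-unique`).
--  * Splitting a composition at its first part gives
--    c (m+1) = Σ_{p≤m} w(p+1)·c(m−p), where w a ∈ {0,1} says whether a is an
--    allowed part (`C-firstPart`).  Since w is k-periodic and w k = 0, this
--    full-history recurrence collapses to the k-term recurrence
--    c (k+M) + [M = 0] = Σ_{p<k} c (k−1+M−p)  (`C-kStep`).
--  * Hence the shifted sequence 0, e 0, e 1, … with e n = c n + f (n+1−k)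
--    satisfies the impulse recurrence (`shifted-isKStep`), so e n = f (n+1),
--    which is the theorem after moving f (n+1−k) to the other side in ℤ.

open import Defs
open import Data.Nat using (ℕ; _≥_; suc; zero; _+_; _*_; _∸_; _≤_; _<_; z≤n; s≤s; _≤?_; _%_)
open import Data.Nat.Properties
open import Data.Nat.DivMod using (n%n≡0; [m+n]%n≡m%n; m<n⇒m%n≡m)
open import Data.Integer using (+_; _-_; _⊖_)
import Data.Integer.Properties as ℤP
open import Data.List using (List; []; _∷_; map; concatMap; upTo; applyUpTo; length; filter; _++_; take)
open import Data.List.Properties using (length-++; filter-++)
open import Data.Bool using (Bool; true; false; not; if_then_else_)
open import Data.Bool.Properties using () renaming (_≟_ to _≟B_)
open import Data.Nat.ListAction using (sum)
open import Data.Bool.ListAction using (and)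
open import Data.Product using (_×_; _,_; proj₂)
open import Relation.Nullary using (yes; no)
open import Relation.Binary.PropositionalEquality
open import Algebra.Properties.CommutativeSemigroup +-commutativeSemigroup
  using (interchange; x∙yz≈xz∙y)

sumTo : ℕ → (ℕ → ℕ) → ℕ
sumTo zero    h = 0
sumTo (suc n) h = h 0 + sumTo n (λ i → h (suc i))

syntax sumTo n (λ i → e) = ∑[ i < n ] e

sumTo-cong : ∀ n {h g : ℕ → ℕ} → (∀ i → i < n → h i ≡ g i) → sumTo n h ≡ sumTo n g
sumTo-cong zero    eq = refl
sumTo-cong (suc n) eq = cong₂ _+_ (eq 0 (s≤s z≤n)) (sumTo-cong n (λ i i<n → eq (suc i) (s≤s i<n)))

sumTo-+ : ∀ a b h → sumTo (a + b) h ≡ sumTo a h + ∑[ j < b ] h (a + j)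
sumTo-+ zero    b h = refl
sumTo-+ (suc a) b h =
  trans (cong (_+_ (h 0)) (sumTo-+ a b (λ i → h (suc i)))) (sym (+-assoc (h 0) _ _))

sumTo-snoc : ∀ n h → sumTo (suc n) h ≡ sumTo n h + h n
sumTo-snoc zero    h = +-identityʳ (h 0)
sumTo-snoc (suc n) h =
  trans (cong (_+_ (h 0)) (sumTo-snoc n (λ i → h (suc i)))) (sym (+-assoc (h 0) _ _))

sumTo-pad : ∀ a b h → a ≤ b → (∀ i → a ≤ i → h i ≡ 0) → sumTo b h ≡ sumTo a h
sumTo-pad zero    zero    h _         _ = refl
sumTo-pad zero    (suc b) h _         vanish =
  cong₂ _+_ (vanish 0 z≤n) (sumTo-pad zero b _ z≤n (λ i _ → vanish (suc i) z≤n))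
sumTo-pad (suc a) (suc b) h (s≤s a≤b) vanish =
  cong (_+_ (h 0)) (sumTo-pad a b _ a≤b (λ i a≤i → vanish (suc i) (s≤s a≤i)))

sumTo-distrib : ∀ n h g → ∑[ i < n ] (h i + g i) ≡ sumTo n h + sumTo n g
sumTo-distrib zero    h g = refl
sumTo-distrib (suc n) h g =
  trans (cong (_+_ (h 0 + g 0)) (sumTo-distrib n _ _)) (interchange (h 0) (g 0) _ _)

sum-applyUpTo : ∀ n (g : ℕ → ℕ) h → sum (map g (applyUpTo h n)) ≡ ∑[ i < n ] g (h i)
sum-applyUpTo zero    g h = refl
sum-applyUpTo (suc n) g h = cong (_+_ (g (h 0))) (sum-applyUpTo n g (λ i → h (suc i)))

admissible : ℕ → List ℕ → Bool
admissible k c = and (map (λ a → not (multipleOf k a)) c)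

countAdmissible : ℕ → List (List ℕ) → ℕ
countAdmissible k L = length (filter (λ c → admissible k c ≟B true) L)

w : ℕ → ℕ → ℕ
w k a = if multipleOf k a then 0 else 1

count-concatMap : ∀ k (G : ℕ → List (List ℕ)) xs →
  countAdmissible k (concatMap G xs) ≡ sum (map (λ x → countAdmissible k (G x)) xs)
count-concatMap k G []       = refl
count-concatMap k G (x ∷ xs) = begin
  length (filter P (G x ++ concatMap G xs))
    ≡⟨ cong length (filter-++ P (G x) (concatMap G xs)) ⟩
  length (filter P (G x) ++ filter P (concatMap G xs))
    ≡⟨ length-++ (filter P (G x)) ⟩
  countAdmissible k (G x) + countAdmissible k (concatMap G xs)
    ≡⟨ cong (_+_ (countAdmissible k (G x))) (count-concatMap k G xs) ⟩
  countAdmissible k (G x) + sum (map (λ y → countAdmissible k (G y)) xs) ∎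
  where
  open ≡-Reasoning
  P = λ c → admissible k c ≟B true

count-forbidden : ∀ k a L → multipleOf k a ≡ true → countAdmissible k (map (a ∷_) L) ≡ 0
count-forbidden k a []      forbidden = refl
count-forbidden k a (c ∷ L) forbidden rewrite forbidden = count-forbidden k a L forbidden

count-allowed : ∀ k a L → multipleOf k a ≡ false →
  countAdmissible k (map (a ∷_) L) ≡ countAdmissible k L
count-allowed k a []      allowed = refl
count-allowed k a (c ∷ L) allowed rewrite allowed with admissible k c
... | true  = cong suc (count-allowed k a L allowed)
... | false = count-allowed k a L allowed

count-prefix : ∀ k a L → countAdmissible k (map (a ∷_) L) ≡ w k a * countAdmissible k L
count-prefix k a L with multipleOf k a in eq
... | true  = count-forbidden k a L eq
... | false = trans (count-allowed k a L eq) (sym (+-identityʳ _))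

concatMap-cong : ∀ {A B : Set} {G H : A → List B} xs → (∀ x → G x ≡ H x) →
  concatMap G xs ≡ concatMap H xs
concatMap-cong []       eq = refl
concatMap-cong (x ∷ xs) eq = cong₂ _++_ (eq x) (concatMap-cong xs eq)

compositionsF-fuel : ∀ f g m → m ≤ f → m ≤ g → compositionsF f m ≡ compositionsF g m
compositionsF-fuel f       g       zero    _         _         = refl
compositionsF-fuel (suc f) (suc g) (suc m) (s≤s m≤f) (s≤s m≤g) =
  concatMap-cong (upTo (suc m)) λ p → cong (map (suc p ∷_))
    (compositionsF-fuel f g (m ∸ p) (≤-trans (m∸n≤m m p) m≤f) (≤-trans (m∸n≤m m p) m≤g))

C-firstPart : ∀ k m → C (suc m) k ≡ ∑[ p < suc m ] (w k (suc p) * C (m ∸ p) k)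
C-firstPart k m = begin
  countAdmissible k (concatMap (λ p → map (suc p ∷_) (rest p)) (upTo (suc m)))
    ≡⟨ count-concatMap k (λ p → map (suc p ∷_) (rest p)) (upTo (suc m)) ⟩
  sum (map (λ p → countAdmissible k (map (suc p ∷_) (rest p))) (upTo (suc m)))
    ≡⟨ sum-applyUpTo (suc m) _ (λ i → i) ⟩
  ∑[ p < suc m ] countAdmissible k (map (suc p ∷_) (rest p))
    ≡⟨ sumTo-cong (suc m) (λ p _ → count-prefix k (suc p) (rest p)) ⟩
  ∑[ p < suc m ] (w k (suc p) * countAdmissible k (rest p))
    ≡⟨ sumTo-cong (suc m) (λ p _ → cong (λ L → w k (suc p) * countAdmissible k L)
         (compositionsF-fuel m (m ∸ p) (m ∸ p) (m∸n≤m m p) ≤-refl)) ⟩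
  ∑[ p < suc m ] (w k (suc p) * C (m ∸ p) k) ∎
  where
  open ≡-Reasoning
  rest : ℕ → List (List ℕ)
  rest p = compositionsF m (m ∸ p)

-- Unit impulse at 0; it records the initial value F(1,k) = 1.
δ : ℕ → ℕ
δ zero    = 1
δ (suc _) = 0

IsKStep : ℕ → (ℕ → ℕ) → Set
IsKStep k g = g 0 ≡ 0 × (∀ m → g (suc m) ≡ ∑[ p < k ] g (m ∸ p) + δ m)

-- The impulse recurrence determines its solution: g (m+1) only depends on
-- values at indices ≤ m, so two solutions agree by strong induction.
kStep-unique : ∀ {k g h} → IsKStep k g → IsKStep k h → ∀ m → g m ≡ h m
kStep-unique {k} {g} {h} (g0 , g-rec) (h0 , h-rec) m = agree m m ≤-refl
  where
  agree : ∀ b m → m ≤ b → g m ≡ h m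
  agree b       zero    _           = trans g0 (sym h0)
  agree (suc b) (suc m) (s≤s m≤b) = begin
    g (suc m)                    ≡⟨ g-rec m ⟩
    ∑[ p < k ] g (m ∸ p) + δ m
      ≡⟨ cong (_+ δ m) (sumTo-cong k (λ p _ → agree b (m ∸ p) (≤-trans (m∸n≤m m p) m≤b))) ⟩
    ∑[ p < k ] h (m ∸ p) + δ m   ≡⟨ sym (h-rec m) ⟩
    h (suc m)                    ∎
    where open ≡-Reasoning

fibsDown-suc : ∀ k m → fibsDown k (suc m) ≡ Fℕ k (suc m) ∷ fibsDown k m
fibsDown-suc k zero    = refl
fibsDown-suc k (suc m) = refl

sum-take-fibsDown : ∀ k j m → sum (take j (fibsDown k m)) ≡ ∑[ p < j ] Fℕ k (m ∸ p)
sum-take-fibsDown k zero          m       = refl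
sum-take-fibsDown k (suc zero)    zero    = refl
sum-take-fibsDown k (suc (suc j)) zero    = sym (sumTo-pad 0 (suc j) _ z≤n (λ _ _ → refl))
sum-take-fibsDown k (suc j)       (suc m) rewrite fibsDown-suc k m =
  cong (_+_ (Fℕ k (suc m))) (sum-take-fibsDown k j m)

F-isKStep : ∀ k → IsKStep k (Fℕ k)
F-isKStep k = refl , recurrence
  where
  recurrence : ∀ m → Fℕ k (suc m) ≡ ∑[ p < k ] Fℕ k (m ∸ p) + δ m
  recurrence zero    = sym (cong (_+ 1) (sumTo-pad 0 k _ z≤n (λ p _ → cong (Fℕ k) (0∸n≡0 p))))
  recurrence (suc m) = trans (sum-take-fibsDown k k (suc m)) (sym (+-identityʳ _))

module FixedStep (k' : ℕ) where

  k : ℕ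
  k = suc k'

  c : ℕ → ℕ
  c n = C n k

  f : ℕ → ℕ
  f = Fℕ k

  k%k≡0 : k % k ≡ 0
  k%k≡0 = n%n≡0 k

  [m+k]%k≡m%k : ∀ m → (m + k) % k ≡ m % k
  [m+k]%k≡m%k m = [m+n]%n≡m%n m k

  w-below : ∀ p → suc p < k → w k (suc p) ≡ 1
  w-below p sp<k rewrite m<n⇒m%n≡m sp<k = refl

  w-k : w k k ≡ 0
  w-k rewrite k%k≡0 = refl

  w-period : ∀ a → w k (a + k) ≡ w k a
  w-period a rewrite [m+k]%k≡m%k a = refl

  -- In the first-part decomposition of c (k+M), the parts larger than k
  -- contribute c M (up to the impulse): shifting such a part down by k is
  -- again a first part of a composition of M, with the same weight.
  C-largeParts : ∀ M → ∑[ j < M ] (w k (suc (k + j)) * c (k' + M ∸ (k + j))) + δ M ≡ c M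
  C-largeParts zero     = refl
  C-largeParts (suc M') = begin
    ∑[ j < suc M' ] (w k (suc (k + j)) * c (k' + suc M' ∸ (k + j))) + 0
      ≡⟨ +-identityʳ _ ⟩
    ∑[ j < suc M' ] (w k (suc (k + j)) * c (k' + suc M' ∸ (k + j)))
      ≡⟨ sumTo-cong (suc M') (λ j _ → cong₂ _*_ (weight j) (cong c (remainder j))) ⟩
    ∑[ j < suc M' ] (w k (suc j) * c (M' ∸ j))
      ≡⟨ sym (C-firstPart k M') ⟩
    c (suc M') ∎
    where
    open ≡-Reasoning
    weight : ∀ j → w k (suc (k + j)) ≡ w k (suc j)
    weight j = trans (cong (λ x → w k (suc x)) (+-comm k j)) (w-period (suc j))
    remainder : ∀ j → k' + suc M' ∸ (k + j) ≡ M' ∸ j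
    remainder j = trans (cong (_∸ suc (k' + j)) (+-suc k' M')) ([m+n]∸[m+o]≡n∸o k' M' j)

  C-smallParts : ∀ m → ∑[ p < k ] (w k (suc p) * c (m ∸ p)) ≡ ∑[ p < k' ] c (m ∸ p)
  C-smallParts m = begin
    ∑[ p < k ] (w k (suc p) * c (m ∸ p))
      ≡⟨ sumTo-snoc k' _ ⟩
    ∑[ p < k' ] (w k (suc p) * c (m ∸ p)) + w k k * c (m ∸ k')
      ≡⟨ cong₂ _+_ (sumTo-cong k' allowed) (cong (_* c (m ∸ k')) w-k) ⟩
    ∑[ p < k' ] c (m ∸ p) + 0
      ≡⟨ +-identityʳ _ ⟩
    ∑[ p < k' ] c (m ∸ p) ∎
    where
    open ≡-Reasoning
    allowed : ∀ p → p < k' → w k (suc p) * c (m ∸ p) ≡ c (m ∸ p)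
    allowed p p<k' = trans (cong (_* c (m ∸ p)) (w-below p (s≤s p<k'))) (+-identityʳ _)

  C-kStep : ∀ M → c (k + M) + δ M ≡ ∑[ p < k ] c (k' + M ∸ p)
  C-kStep M = begin
    c (k + M) + δ M
      ≡⟨ cong (_+ δ M) (trans (C-firstPart k (k' + M)) (sumTo-+ k M h)) ⟩
    (∑[ p < k ] h p + ∑[ j < M ] h (k + j)) + δ M
      ≡⟨ +-assoc (sumTo k h) _ (δ M) ⟩
    ∑[ p < k ] h p + (∑[ j < M ] h (k + j) + δ M)
      ≡⟨ cong₂ _+_ (C-smallParts (k' + M)) (C-largeParts M) ⟩
    ∑[ p < k' ] c (k' + M ∸ p) + c M
      ≡⟨ cong (λ x → ∑[ p < k' ] c (k' + M ∸ p) + c x) (sym (m+n∸m≡n k' M)) ⟩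
    ∑[ p < k' ] c (k' + M ∸ p) + c (k' + M ∸ k')
      ≡⟨ sym (sumTo-snoc k' (λ p → c (k' + M ∸ p))) ⟩
    ∑[ p < k ] c (k' + M ∸ p) ∎
    where
    open ≡-Reasoning
    h : ℕ → ℕ
    h p = w k (suc p) * c (k' + M ∸ p)

  -- e n = c n + f (n+1−k), with F at non-positive indices read as f 0 = 0.
  e : ℕ → ℕ
  e n = c n + f (suc n ∸ k)

  shifted : ℕ → ℕ
  shifted zero    = 0
  shifted (suc n) = e n

  shifted-suc∸ : ∀ {m p} → p ≤ m → shifted (suc m ∸ p) ≡ e (m ∸ p)
  shifted-suc∸ p≤m = cong shifted (+-∸-assoc 1 p≤m)

  e-below : ∀ n → n < k → e n ≡ c n
  e-below n (s≤s n≤k') = trans (cong (λ x → c n + f x) (m≤n⇒m∸n≡0 n≤k')) (+-identityʳ _)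

  -- For n < k every part is allowed, so c n = Σ_{p<n} c (n−1−p) + [n = 0].
  e-rec-below : ∀ n → n < k → e n ≡ ∑[ p < k ] shifted (n ∸ p) + δ n
  e-rec-below zero    0<k = begin
    e 0                               ≡⟨ e-below 0 0<k ⟩
    1                                 ≡⟨ cong (_+ 1) (sym (sumTo-pad 0 k _ z≤n vanish)) ⟩
    ∑[ p < k ] shifted (0 ∸ p) + 1    ∎
    where
    open ≡-Reasoning
    vanish : ∀ p → 0 ≤ p → shifted (0 ∸ p) ≡ 0
    vanish p _ = cong shifted (0∸n≡0 p)
  e-rec-below (suc m) sm<k@(s≤s sm≤k') = begin
    e (suc m)                                    ≡⟨ e-below (suc m) sm<k ⟩
    c (suc m)                                    ≡⟨ C-firstPart k m ⟩
    ∑[ p < suc m ] (w k (suc p) * c (m ∸ p))     ≡⟨ sumTo-cong (suc m) term ⟩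
    ∑[ p < suc m ] shifted (suc m ∸ p)           ≡⟨ sym (sumTo-pad (suc m) k _ (m≤n⇒m≤1+n sm≤k') vanish) ⟩
    ∑[ p < k ] shifted (suc m ∸ p)               ≡⟨ sym (+-identityʳ _) ⟩
    ∑[ p < k ] shifted (suc m ∸ p) + 0           ∎
    where
    open ≡-Reasoning
    term : ∀ p → p < suc m → w k (suc p) * c (m ∸ p) ≡ shifted (suc m ∸ p)
    term p (s≤s p≤m) = begin
      w k (suc p) * c (m ∸ p) ≡⟨ cong (_* c (m ∸ p)) (w-below p (≤-<-trans (s≤s p≤m) sm<k)) ⟩
      c (m ∸ p) + 0           ≡⟨ +-identityʳ _ ⟩
      c (m ∸ p)               ≡⟨ sym (e-below (m ∸ p) (≤-<-trans (m∸n≤m m p) (<-trans (n<1+n m) sm<k))) ⟩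
      e (m ∸ p)               ≡⟨ sym (shifted-suc∸ p≤m) ⟩
      shifted (suc m ∸ p)     ∎
    vanish : ∀ p → suc m ≤ p → shifted (suc m ∸ p) ≡ 0
    vanish p sm≤p = cong shifted (m≤n⇒m∸n≡0 sm≤p)

  -- From k on, e inherits the k-term recurrence: add `C-kStep` to the
  -- Fibonacci recurrence at M.
  e-rec-above : ∀ M → e (k + M) ≡ ∑[ p < k ] shifted (k + M ∸ p) + δ (k + M)
  e-rec-above M = begin
    c (k + M) + f (suc (k + M) ∸ k)
      ≡⟨ cong (λ x → c (k + M) + f x) index ⟩
    c (k + M) + f (suc M)
      ≡⟨ cong (_+_ (c (k + M))) (proj₂ (F-isKStep k) M) ⟩
    c (k + M) + (∑[ p < k ] f (M ∸ p) + δ M)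
      ≡⟨ x∙yz≈xz∙y (c (k + M)) _ (δ M) ⟩
    (c (k + M) + δ M) + ∑[ p < k ] f (M ∸ p)
      ≡⟨ cong (_+ sumTo k (λ p → f (M ∸ p))) (C-kStep M) ⟩
    ∑[ p < k ] c (k' + M ∸ p) + ∑[ p < k ] f (M ∸ p)
      ≡⟨ sym (sumTo-distrib k (λ p → c (k' + M ∸ p)) (λ p → f (M ∸ p))) ⟩
    ∑[ p < k ] (c (k' + M ∸ p) + f (M ∸ p))
      ≡⟨ sumTo-cong k term ⟩
    ∑[ p < k ] shifted (k + M ∸ p)
      ≡⟨ sym (+-identityʳ _) ⟩
    ∑[ p < k ] shifted (k + M ∸ p) + 0 ∎
    where
    open ≡-Reasoning
    index : suc (k + M) ∸ k ≡ suc M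
    index = trans (cong (_∸ k') (sym (+-suc k' M))) (m+n∸m≡n k' (suc M))
    term : ∀ p → p < k → c (k' + M ∸ p) + f (M ∸ p) ≡ shifted (k + M ∸ p)
    term p (s≤s p≤k') = begin
      c (k' + M ∸ p) + f (M ∸ p)           ≡⟨ cong (λ x → c (k' + M ∸ p) + f x) (sym shift) ⟩
      e (k' + M ∸ p)                       ≡⟨ sym (shifted-suc∸ (≤-trans p≤k' (m≤m+n k' M))) ⟩
      shifted (k + M ∸ p)                  ∎
      where
      shift : k' + M ∸ p ∸ k' ≡ M ∸ p
      shift = begin
        k' + M ∸ p ∸ k'   ≡⟨ ∸-+-assoc (k' + M) p k' ⟩
        k' + M ∸ (p + k') ≡⟨ cong (k' + M ∸_) (+-comm p k') ⟩
        k' + M ∸ (k' + p) ≡⟨ [m+n]∸[m+o]≡n∸o k' M p ⟩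
        M ∸ p             ∎

  shifted-isKStep : IsKStep k shifted
  shifted-isKStep = refl , recurrence
    where
    recurrence : ∀ n → e n ≡ ∑[ p < k ] shifted (n ∸ p) + δ n
    recurrence n with k ≤? n
    ... | no  n≱k = e-rec-below n (≰⇒> n≱k)
    ... | yes k≤n = subst (λ m → e m ≡ ∑[ p < k ] shifted (m ∸ p) + δ m)
                          (m+[n∸m]≡n k≤n) (e-rec-above (n ∸ k))

  C+F≡F : ∀ n → c n + f (suc n ∸ k) ≡ f (suc n)
  C+F≡F n = kStep-unique {k} {shifted} {f} shifted-isKStep (F-isKStep k) (suc n)

-- F at an integer difference a − b is F at the truncated difference a ∸ b,
-- because F vanishes at non-positive indices and F(0,k) = 0.
F-⊖ : ∀ k a b → F (a ⊖ b) k ≡ Fℕ k (a ∸ b)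
F-⊖ k a       zero    = cong (λ i → F i k) (ℤP.⊖-≥ {a} z≤n)
F-⊖ k zero    (suc b) = refl
F-⊖ k (suc a) (suc b) = trans (cong (λ i → F i k) (ℤP.[1+m]⊖[1+n]≡m⊖n a b)) (F-⊖ k a b)

F-minus : ∀ k a b → F (+ a - + b) k ≡ Fℕ k (a ∸ b)
F-minus k a b = trans (cong (λ i → F i k) (ℤP.m-n≡m⊖n a b)) (F-⊖ k a b)

+-to-minus : ∀ {x y z} → x + y ≡ z → + x ≡ + z - + y
+-to-minus {x} {y} refl = begin
  + x               ≡⟨ cong +_ (sym (m+n∸n≡m x y)) ⟩
  + (x + y ∸ y)     ≡⟨ sym (ℤP.⊖-≥ (m≤n+m y x)) ⟩
  (x + y) ⊖ y       ≡⟨ sym (ℤP.m-n≡m⊖n (x + y) y) ⟩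
  + (x + y) - + y   ∎
  where open ≡-Reasoning

mainTheorem18 : (n k : ℕ) → k ≥ 1 →
    + C n k ≡ + F (+ suc n) k - + F (+ suc n - + k) k
mainTheorem18 n (suc k') (s≤s z≤n) = begin
  + C n k                                 ≡⟨ +-to-minus (C+F≡F n) ⟩
  + F (+ suc n) k - + Fℕ k (suc n ∸ k)   ≡⟨ cong (λ x → + F (+ suc n) k - + x) (sym (F-minus k (suc n) k)) ⟩
  + F (+ suc n) k - + F (+ suc n - + k) k ∎
  where
  open ≡-Reasoning
  open FixedStep k'
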